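{- Let $f(X,Y)=X^4+a_2X^2Y^2+a_3XY^3+a_4Y^4\in\mathbb{Z}[X,Y]$. Let $\gamma\in\mathrm{PGL}_2(\mathbb{Q})$ be such that $\gamma\cdot f$ is flattened, and represent $\gamma$ by a matrix $\begin{pmatrix}a&b\\c&d\end{pmatrix}$ with $a,b,c,d\in\mathbb{Z}$ and $\gcd(a,b,c,d)=1$. Then (i) $\gcd(a,b)=1$, and (ii) $f(a,b)=(\det\gamma)^2$, and this quantity divides the discriminant $\Delta(f)$ of $f$.
   Context: A binary quartic form $aX^4+bX^3Y+cX^2Y^2+dXY^3+eY^4$ is called flattened if it has integer coefficients, is monic ($a=1$) and has zero $X^3Y$-coefficient ($b=0$). $\mathrm{PGL}_2(\mathbb{Q})$ acts on rational binary quartic forms via the twisted action $(g\cdot f)(X,Y)=(\det g)^{ -2}f((X,Y)\cdot g)$ for $g\in\mathrm{GL}_2(\mathbb{Q})$. With $I=12ae-3bd+c^2$ and $J=72ace-27ad^2-27b^2e+9bcd-2c^3$, the discriminant is $\Delta(f)=\frac{1}{27}(4I^3-J^2)$. -}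

module Defs where

open import Data.Nat using (ℕ; zero; suc)
open import Data.Integer using (ℤ; +_; _+_; _*_; _-_; -_; _^_)
open import Data.Integer.DivMod using (_/_)
open import Data.List using (List; []; _∷_; map)
open import Data.Product using (_×_; Σ; _,_)
open import Relation.Binary.PropositionalEquality using (_≡_)

record Quartic : Set where
  constructor quartic
  field
    c0 c1 c2 c3 c4 : ℤ
open Quartic public

eval : Quartic → ℤ → ℤ → ℤ
eval f x y = c0 f * x ^ 4 + c1 f * x ^ 3 * y + c2 f * x ^ 2 * y ^ 2
           + c3 f * x * y ^ 3 + c4 f * y ^ 4

-- Homogeneous binary forms as coefficient lists (index k = coefficient of X^(n-k) Y^k).
addP : List ℤ → List ℤ → List ℤ
addP [] q = q
addP (x ∷ p) [] = x ∷ p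
addP (x ∷ p) (y ∷ q) = (x + y) ∷ addP p q

mulP : List ℤ → List ℤ → List ℤ
mulP [] q = []
mulP (x ∷ p) q = addP (map (x *_) q) (+ 0 ∷ mulP p q)

powP : List ℤ → ℕ → List ℤ
powP p zero = + 1 ∷ []
powP p (suc n) = mulP p (powP p n)

scaleP : ℤ → List ℤ → List ℤ
scaleP s p = map (s *_) p

coeffP : List ℤ → ℕ → ℤ
coeffP [] _ = + 0
coeffP (x ∷ p) zero = x
coeffP (x ∷ p) (suc k) = coeffP p k

det : ℤ → ℤ → ℤ → ℤ → ℤ
det a b c d = a * d - b * c

-- The untwisted substitution  f((X,Y)·g) = f(aX + cY, bX + dY)  for g = (a b ; c d),
-- as a quartic form with integer coefficients.
substForm : Quartic → ℤ → ℤ → ℤ → ℤ → Quartic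
substForm f a b c d = quartic (coeffP s 0) (coeffP s 1) (coeffP s 2) (coeffP s 3) (coeffP s 4)
  where
    u v s : List ℤ
    u = a ∷ c ∷ []
    v = b ∷ d ∷ []
    s = addP (scaleP (c0 f) (powP u 4))
        (addP (scaleP (c1 f) (mulP (powP u 3) v))
        (addP (scaleP (c2 f) (mulP (powP u 2) (powP v 2)))
        (addP (scaleP (c3 f) (mulP u (powP v 3)))
              (scaleP (c4 f) (powP v 4)))))

-- Flattened: integer coefficients (automatic for Quartic), monic, zero X^3Y coefficient.
Flattened : Quartic → Set
Flattened h = (c0 h ≡ + 1) × (c1 h ≡ + 0)

-- "g · f is flattened" for the twisted action (g·f)(X,Y) = (det g)^(-2) f((X,Y)·g):
-- there is a flattened integral quartic h with g·f = h, i.e. (det g)^2 · h = f((X,Y)·g)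
-- coefficientwise (det g ≠ 0 is assumed separately).
TwistFlattened : Quartic → ℤ → ℤ → ℤ → ℤ → Set
TwistFlattened f a b c d =
  Σ Quartic λ h → Flattened h ×
    ((c0 (substForm f a b c d) ≡ D² * c0 h) ×
     (c1 (substForm f a b c d) ≡ D² * c1 h) ×
     (c2 (substForm f a b c d) ≡ D² * c2 h) ×
     (c3 (substForm f a b c d) ≡ D² * c3 h) ×
     (c4 (substForm f a b c d) ≡ D² * c4 h))
  where
    D² : ℤ
    D² = det a b c d ^ 2

-- Invariants I, J and the discriminant Δ = (4 I^3 - J^2) / 27 (an exact division for
-- integral forms).
invI : Quartic → ℤ
invI (quartic a b c d e) = + 12 * a * e - + 3 * b * d + c ^ 2

invJ : Quartic → ℤ
invJ (quartic a b c d e) =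
  + 72 * a * c * e - + 27 * a * d ^ 2 - + 27 * b ^ 2 * e + + 9 * b * c * d - + 2 * c ^ 3

disc : Quartic → ℤ
disc f = (+ 4 * invI f ^ 3 - invJ f ^ 2) / + 27

{-# OPTIONS --safe #-}

-- Write T = det γ and f ∘ γ = T² h with h monic.  Evaluating f ∘ γ at the rows (d, -b) and
-- (-c, a) of adj γ gives f(T, 0) = f₀ T⁴ and f(0, T) = f₄ T⁴, so h(d, -b) and h(-c, a) are
-- multiples of T².  As h is monic, d⁴ ≡ h(d, -b) (mod b) and c⁴ ≡ h(-c, a) (mod a); hence
-- gcd(a, b), which divides T, divides c⁴ and d⁴, and being coprime to gcd(c, d) it is 1.
-- For the discriminant, complete (a, b) to γ' ∈ SL₂(ℤ) with second row (c', d'), so that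
-- Δ(f) = Δ(f ∘ γ'), and use Δ(F) = F₀ P(F) + F₁² Q(F) with P, Q integral.  Here F₀ = f(a, b) = T²,
-- and F₁ = c' ∂ₓf(a, b) + d' ∂ᵧf(a, b) is divisible by T: Euler's identity and the vanishing
-- X³Y-coefficient of f ∘ γ force T ∇f(a, b) = 4T² (d, -c).  The SL₂-invariance of J comes from
-- 4J being the determinant of the catalecticant matrix, which transforms by congruence under Sym² γ.

module Submission where

open import Defs
open import Data.Integer using (ℤ; +_; _^_)
open import Data.Integer.GCD using (gcd)
open import Data.Integer.Divisibility using (_∣_)
open import Data.Product using (_×_)
open import Relation.Binary.PropositionalEquality using (_≡_; _≢_)

open import Data.Integer.Base using (_+_; _*_; _-_; -_; ∣_∣; 0ℤ; 1ℤ; -1ℤ; NonZero; ≢-nonZero)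
open import Data.Integer.Properties
  using (*-identityˡ; *-identityʳ; *-zeroʳ; *-cancelˡ-≡; -1*i≡-i; +∣i∣≡i⊎+∣i∣≡-i; ∣-i∣≡∣i∣;
         abs-*; pos-+; pos-*; +-injective; i^n≡0⇒i≡0; i-j≡0⇒i≡j; ∣i∣≡0⇒i≡0)
open import Data.Integer.DivMod using (_/_; _%_; a≡a%n+[a/n]*n; n%d<d)
open import Data.Integer.GCD using (gcd[i,j]∣i; gcd[i,j]∣j)
import Data.Integer.Divisibility.Signed as ℤˢ
open import Data.Integer.Solver using (module +-*-Solver)
open +-*-Solver using (Polynomial; con; _:+_; _:*_; _:-_; :-_; _:^_; solve; _:=_)
open import Data.Nat as ℕ using (ℕ; zero; suc)
import Data.Nat.Properties as ℕ
import Data.Nat.Divisibility as ℕ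
import Data.Nat.GCD as ℕ
import Data.Nat.Coprimality as ℕ
open import Data.List using (List; []; _∷_; map)
open import Data.Product using (∃; ∃₂; _,_; proj₁; proj₂)
open import Data.Sum using (inj₁; inj₂)
open import Relation.Binary.PropositionalEquality
  using (refl; sym; trans; cong; cong₂; subst; subst₂; module ≡-Reasoning)
open ≡-Reasoning

record Arith (R : Set) : Set where
  infixl 6 _+ᴿ_
  infixl 7 _*ᴿ_
  infixr 8 _^ᴿ_
  field
    #_   : ℕ → R
    _+ᴿ_ : R → R → R
    _*ᴿ_ : R → R → R
    -ᴿ_  : R → R
    _^ᴿ_ : R → ℕ → R

record Mat₃ (R : Set) : Set where
  constructor mat₃
  field
    e₁₁ e₁₂ e₁₃ e₂₁ e₂₂ e₂₃ e₃₁ e₃₂ e₃₃ : R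
open Mat₃

transpose : ∀ {R} → Mat₃ R → Mat₃ R
transpose (mat₃ x₁₁ x₁₂ x₁₃ x₂₁ x₂₂ x₂₃ x₃₁ x₃₂ x₃₃) =
  mat₃ x₁₁ x₂₁ x₃₁ x₁₂ x₂₂ x₃₂ x₁₃ x₂₃ x₃₃

-- Every polynomial formula below is written once over an arbitrary Arith, then read both in ℤ
-- and in the syntax of the ring solver.  The list operations copy those of Defs verbatim, so the
-- interpretation of a syntactic substituted coefficient reduces to the corresponding coefficient
-- of substForm and the solver applies to it.
module Formulas {R : Set} (arith : Arith R) where
  open Arith arith

  infixl 6 _-ᴿ_
  _-ᴿ_ : R → R → R
  x -ᴿ y = x +ᴿ (-ᴿ y)

  addL mulL : List R → List R → List R
  addL [] q = q
  addL (x ∷ p) [] = x ∷ p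
  addL (x ∷ p) (y ∷ q) = (x +ᴿ y) ∷ addL p q
  mulL [] q = []
  mulL (x ∷ p) q = addL (map (x *ᴿ_) q) (# 0 ∷ mulL p q)

  powL : List R → ℕ → List R
  powL p zero = # 1 ∷ []
  powL p (suc n) = mulL p (powL p n)

  coeffL : List R → ℕ → R
  coeffL [] _ = # 0
  coeffL (x ∷ p) zero = x
  coeffL (x ∷ p) (suc k) = coeffL p k

  substCoeff : (A B C D E a b c d : R) → ℕ → R
  substCoeff A B C D E a b c d = coeffL s
    where
    u v s : List R
    u = a ∷ c ∷ []
    v = b ∷ d ∷ []
    s = addL (map (A *ᴿ_) (powL u 4))
        (addL (map (B *ᴿ_) (mulL (powL u 3) v))
        (addL (map (C *ᴿ_) (mulL (powL u 2) (powL v 2)))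
        (addL (map (D *ᴿ_) (mulL u (powL v 3)))
              (map (E *ᴿ_) (powL v 4)))))

  evalF : (A B C D E x y : R) → R
  evalF A B C D E x y = A *ᴿ x ^ᴿ 4 +ᴿ B *ᴿ x ^ᴿ 3 *ᴿ y +ᴿ C *ᴿ x ^ᴿ 2 *ᴿ y ^ᴿ 2
                      +ᴿ D *ᴿ x *ᴿ y ^ᴿ 3 +ᴿ E *ᴿ y ^ᴿ 4

  invIF invJF : (A B C D E : R) → R
  invIF A B C D E = # 12 *ᴿ A *ᴿ E -ᴿ # 3 *ᴿ B *ᴿ D +ᴿ C ^ᴿ 2
  invJF A B C D E = # 72 *ᴿ A *ᴿ C *ᴿ E -ᴿ # 27 *ᴿ A *ᴿ D ^ᴿ 2 -ᴿ # 27 *ᴿ B ^ᴿ 2 *ᴿ E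
                  +ᴿ # 9 *ᴿ B *ᴿ C *ᴿ D -ᴿ # 2 *ᴿ C ^ᴿ 3

  detF : (a b c d : R) → R
  detF a b c d = a *ᴿ d -ᴿ b *ᴿ c

  ∂XF ∂YF : (A B C D E x y : R) → R
  ∂XF A B C D E x y = # 4 *ᴿ A *ᴿ x ^ᴿ 3 +ᴿ # 3 *ᴿ B *ᴿ x ^ᴿ 2 *ᴿ y +ᴿ # 2 *ᴿ C *ᴿ x *ᴿ y ^ᴿ 2
                    +ᴿ D *ᴿ y ^ᴿ 3
  ∂YF A B C D E x y = B *ᴿ x ^ᴿ 3 +ᴿ # 2 *ᴿ C *ᴿ x ^ᴿ 2 *ᴿ y +ᴿ # 3 *ᴿ D *ᴿ x *ᴿ y ^ᴿ 2
                    +ᴿ # 4 *ᴿ E *ᴿ y ^ᴿ 3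

  discPF discQF : (A B C D E : R) → R
  discPF A B C D E =
    # 256 *ᴿ A ^ᴿ 2 *ᴿ E ^ᴿ 3 -ᴿ # 192 *ᴿ A *ᴿ B *ᴿ D *ᴿ E ^ᴿ 2 -ᴿ # 128 *ᴿ A *ᴿ C ^ᴿ 2 *ᴿ E ^ᴿ 2
    +ᴿ # 144 *ᴿ A *ᴿ C *ᴿ D ^ᴿ 2 *ᴿ E -ᴿ # 27 *ᴿ A *ᴿ D ^ᴿ 4 +ᴿ # 144 *ᴿ B ^ᴿ 2 *ᴿ C *ᴿ E ^ᴿ 2
    -ᴿ # 6 *ᴿ B ^ᴿ 2 *ᴿ D ^ᴿ 2 *ᴿ E -ᴿ # 80 *ᴿ B *ᴿ C ^ᴿ 2 *ᴿ D *ᴿ E +ᴿ # 18 *ᴿ B *ᴿ C *ᴿ D ^ᴿ 3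
    +ᴿ # 16 *ᴿ C ^ᴿ 4 *ᴿ E -ᴿ # 4 *ᴿ C ^ᴿ 3 *ᴿ D ^ᴿ 2
  discQF A B C D E =
    C ^ᴿ 2 *ᴿ D ^ᴿ 2 -ᴿ # 4 *ᴿ C ^ᴿ 3 *ᴿ E -ᴿ # 4 *ᴿ B *ᴿ D ^ᴿ 3 +ᴿ # 18 *ᴿ B *ᴿ C *ᴿ D *ᴿ E
    -ᴿ # 27 *ᴿ B ^ᴿ 2 *ᴿ E ^ᴿ 2

  det₃ : Mat₃ R → R
  det₃ (mat₃ x₁₁ x₁₂ x₁₃ x₂₁ x₂₂ x₂₃ x₃₁ x₃₂ x₃₃) =
    x₁₁ *ᴿ (x₂₂ *ᴿ x₃₃ -ᴿ x₂₃ *ᴿ x₃₂) -ᴿ x₁₂ *ᴿ (x₂₁ *ᴿ x₃₃ -ᴿ x₂₃ *ᴿ x₃₁)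
    +ᴿ x₁₃ *ᴿ (x₂₁ *ᴿ x₃₂ -ᴿ x₂₂ *ᴿ x₃₁)

  infixl 7 _·_
  _·_ : Mat₃ R → Mat₃ R → Mat₃ R
  mat₃ x₁₁ x₁₂ x₁₃ x₂₁ x₂₂ x₂₃ x₃₁ x₃₂ x₃₃ · mat₃ y₁₁ y₁₂ y₁₃ y₂₁ y₂₂ y₂₃ y₃₁ y₃₂ y₃₃ =
    mat₃ (x₁₁ *ᴿ y₁₁ +ᴿ x₁₂ *ᴿ y₂₁ +ᴿ x₁₃ *ᴿ y₃₁) (x₁₁ *ᴿ y₁₂ +ᴿ x₁₂ *ᴿ y₂₂ +ᴿ x₁₃ *ᴿ y₃₂)
         (x₁₁ *ᴿ y₁₃ +ᴿ x₁₂ *ᴿ y₂₃ +ᴿ x₁₃ *ᴿ y₃₃)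
         (x₂₁ *ᴿ y₁₁ +ᴿ x₂₂ *ᴿ y₂₁ +ᴿ x₂₃ *ᴿ y₃₁) (x₂₁ *ᴿ y₁₂ +ᴿ x₂₂ *ᴿ y₂₂ +ᴿ x₂₃ *ᴿ y₃₂)
         (x₂₁ *ᴿ y₁₃ +ᴿ x₂₂ *ᴿ y₂₃ +ᴿ x₂₃ *ᴿ y₃₃)
         (x₃₁ *ᴿ y₁₁ +ᴿ x₃₂ *ᴿ y₂₁ +ᴿ x₃₃ *ᴿ y₃₁) (x₃₁ *ᴿ y₁₂ +ᴿ x₃₂ *ᴿ y₂₂ +ᴿ x₃₃ *ᴿ y₃₂)
         (x₃₁ *ᴿ y₁₃ +ᴿ x₃₂ *ᴿ y₂₃ +ᴿ x₃₃ *ᴿ y₃₃)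

  catalecticantF : (A B C D E : R) → Mat₃ R
  catalecticantF A B C D E =
    mat₃ (# 12 *ᴿ A) (# 3 *ᴿ B) (# 2 *ᴿ C)
         (# 3 *ᴿ B)  (# 2 *ᴿ C) (# 3 *ᴿ D)
         (# 2 *ᴿ C)  (# 3 *ᴿ D) (# 12 *ᴿ E)

  sym² : (a b c d : R) → Mat₃ R
  sym² a b c d =
    mat₃ (a *ᴿ a) (# 2 *ᴿ a *ᴿ b)         (b *ᴿ b)
         (a *ᴿ c) (a *ᴿ d +ᴿ b *ᴿ c)      (b *ᴿ d)
         (c *ᴿ c) (# 2 *ᴿ c *ᴿ d)         (d *ᴿ d)

ℤ-arith : Arith ℤ
ℤ-arith = record { #_ = +_ ; _+ᴿ_ = _+_ ; _*ᴿ_ = _*_ ; -ᴿ_ = -_ ; _^ᴿ_ = _^_ }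

syntax-arith : ∀ {n} → Arith (Polynomial n)
syntax-arith = record { #_ = λ k → con (+ k) ; _+ᴿ_ = _:+_ ; _*ᴿ_ = _:*_ ; -ᴿ_ = :-_ ; _^ᴿ_ = _:^_ }

module ℤF = Formulas ℤ-arith
module S {n} = Formulas (syntax-arith {n})
open ℤF using (det₃; _·_; sym²)

∂X ∂Y : Quartic → ℤ → ℤ → ℤ
∂X f = ℤF.∂XF (c0 f) (c1 f) (c2 f) (c3 f) (c4 f)
∂Y f = ℤF.∂YF (c0 f) (c1 f) (c2 f) (c3 f) (c4 f)

discP discQ : Quartic → ℤ
discP f = ℤF.discPF (c0 f) (c1 f) (c2 f) (c3 f) (c4 f)
discQ f = ℤF.discQF (c0 f) (c1 f) (c2 f) (c3 f) (c4 f)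

catalecticant : Quartic → Mat₃ ℤ
catalecticant f = ℤF.catalecticantF (c0 f) (c1 f) (c2 f) (c3 f) (c4 f)

scale : ℤ → Quartic → Quartic
scale s h = quartic (s * c0 h) (s * c1 h) (s * c2 h) (s * c3 h) (s * c4 h)

quartic-≡ : ∀ {F G} → c0 F ≡ c0 G → c1 F ≡ c1 G → c2 F ≡ c2 G → c3 F ≡ c3 G → c4 F ≡ c4 G → F ≡ G
quartic-≡ refl refl refl refl refl = refl

mat₃-≡ : ∀ {R} {M N : Mat₃ R} → e₁₁ M ≡ e₁₁ N → e₁₂ M ≡ e₁₂ N → e₁₃ M ≡ e₁₃ N →
         e₂₁ M ≡ e₂₁ N → e₂₂ M ≡ e₂₂ N → e₂₃ M ≡ e₂₃ N →
         e₃₁ M ≡ e₃₁ N → e₃₂ M ≡ e₃₂ N → e₃₃ M ≡ e₃₃ N → M ≡ N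
mat₃-≡ refl refl refl refl refl refl refl refl refl = refl

eval-substForm : ∀ f a b c d x y →
  eval (substForm f a b c d) x y ≡ eval f (a * x + c * y) (b * x + d * y)
eval-substForm (quartic A B C D E) = solve 11 (λ A B C D E a b c d x y →
  let σ = S.substCoeff A B C D E a b c d in
  S.evalF (σ 0) (σ 1) (σ 2) (σ 3) (σ 4) x y := S.evalF A B C D E (a :* x :+ c :* y) (b :* x :+ d :* y))
  refl A B C D E

c0-substForm : ∀ f a b c d → c0 (substForm f a b c d) ≡ eval f a b
c0-substForm (quartic A B C D E) = solve 9 (λ A B C D E a b c d →
  S.substCoeff A B C D E a b c d 0 := S.evalF A B C D E a b) refl A B C D E

c1-substForm : ∀ f a b c d → c1 (substForm f a b c d) ≡ c * ∂X f a b + d * ∂Y f a b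
c1-substForm (quartic A B C D E) = solve 9 (λ A B C D E a b c d →
  S.substCoeff A B C D E a b c d 1 := c :* S.∂XF A B C D E a b :+ d :* S.∂YF A B C D E a b)
  refl A B C D E

eval-on-X-axis : ∀ f x → eval f x 0ℤ ≡ c0 f * x ^ 4
eval-on-X-axis (quartic A B C D E) = solve 6 (λ A B C D E x →
  S.evalF A B C D E x (con (+ 0)) := A :* x :^ 4) refl A B C D E

eval-on-Y-axis : ∀ f y → eval f 0ℤ y ≡ c4 f * y ^ 4
eval-on-Y-axis (quartic A B C D E) = solve 6 (λ A B C D E y →
  S.evalF A B C D E (con (+ 0)) y := E :* y :^ 4) refl A B C D E

euler : ∀ f x y → x * ∂X f x y + y * ∂Y f x y ≡ + 4 * eval f x y
euler (quartic A B C D E) = solve 7 (λ A B C D E x y →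
  x :* S.∂XF A B C D E x y :+ y :* S.∂YF A B C D E x y := con (+ 4) :* S.evalF A B C D E x y)
  refl A B C D E

eval-scale : ∀ s h x y → eval (scale s h) x y ≡ s * eval h x y
eval-scale s (quartic A B C D E) = solve 8 (λ s A B C D E x y →
  S.evalF (s :* A) (s :* B) (s :* C) (s :* D) (s :* E) x y := s :* S.evalF A B C D E x y)
  refl s A B C D E

eval-leading-term : ∀ h x y →
  eval h x y ≡ c0 h * x ^ 4 + y * (c1 h * x ^ 3 + c2 h * x ^ 2 * y + c3 h * x * y ^ 2 + c4 h * y ^ 3)
eval-leading-term (quartic A B C D E) = solve 7 (λ A B C D E x y →
  S.evalF A B C D E x y
    := A :* x :^ 4 :+ y :* (B :* x :^ 3 :+ C :* x :^ 2 :* y :+ D :* x :* y :^ 2 :+ E :* y :^ 3))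
  refl A B C D E

invI-substForm : ∀ f a b c d → invI (substForm f a b c d) ≡ det a b c d ^ 4 * invI f
invI-substForm (quartic A B C D E) = solve 9 (λ A B C D E a b c d →
  let σ = S.substCoeff A B C D E a b c d in
  S.invIF (σ 0) (σ 1) (σ 2) (σ 3) (σ 4) := S.detF a b c d :^ 4 :* S.invIF A B C D E)
  refl A B C D E

det₃-· : ∀ M N → det₃ (M · N) ≡ det₃ M * det₃ N
det₃-· (mat₃ x₁₁ x₁₂ x₁₃ x₂₁ x₂₂ x₂₃ x₃₁ x₃₂ x₃₃) (mat₃ y₁₁ y₁₂ y₁₃ y₂₁ y₂₂ y₂₃ y₃₁ y₃₂ y₃₃) =
  solve 18 (λ x₁₁ x₁₂ x₁₃ x₂₁ x₂₂ x₂₃ x₃₁ x₃₂ x₃₃ y₁₁ y₁₂ y₁₃ y₂₁ y₂₂ y₂₃ y₃₁ y₃₂ y₃₃ →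
    let X = mat₃ x₁₁ x₁₂ x₁₃ x₂₁ x₂₂ x₂₃ x₃₁ x₃₂ x₃₃
        Y = mat₃ y₁₁ y₁₂ y₁₃ y₂₁ y₂₂ y₂₃ y₃₁ y₃₂ y₃₃ in
    S.det₃ (X S.· Y) := S.det₃ X :* S.det₃ Y)
    refl x₁₁ x₁₂ x₁₃ x₂₁ x₂₂ x₂₃ x₃₁ x₃₂ x₃₃ y₁₁ y₁₂ y₁₃ y₂₁ y₂₂ y₂₃ y₃₁ y₃₂ y₃₃

det₃-transpose : ∀ M → det₃ (transpose M) ≡ det₃ M
det₃-transpose (mat₃ x₁₁ x₁₂ x₁₃ x₂₁ x₂₂ x₂₃ x₃₁ x₃₂ x₃₃) =
  solve 9 (λ x₁₁ x₁₂ x₁₃ x₂₁ x₂₂ x₂₃ x₃₁ x₃₂ x₃₃ →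
    let X = mat₃ x₁₁ x₁₂ x₁₃ x₂₁ x₂₂ x₂₃ x₃₁ x₃₂ x₃₃ in
    S.det₃ (transpose X) := S.det₃ X)
    refl x₁₁ x₁₂ x₁₃ x₂₁ x₂₂ x₂₃ x₃₁ x₃₂ x₃₃

det₃-sym² : ∀ a b c d → det₃ (sym² a b c d) ≡ det a b c d ^ 3
det₃-sym² = solve 4 (λ a b c d → S.det₃ (S.sym² a b c d) := S.detF a b c d :^ 3) refl

det₃-catalecticant : ∀ f → det₃ (catalecticant f) ≡ + 4 * invJ f
det₃-catalecticant (quartic A B C D E) = solve 5 (λ A B C D E →
  S.det₃ (S.catalecticantF A B C D E) := con (+ 4) :* S.invJF A B C D E) refl A B C D E

catalecticant-substForm : ∀ f a b c d →
  catalecticant (substForm f a b c d) ≡ sym² a b c d · catalecticant f · transpose (sym² a b c d)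
catalecticant-substForm (quartic A B C D E) a b c d = mat₃-≡
  (solve 9 (entry e₁₁) refl A B C D E a b c d) (solve 9 (entry e₁₂) refl A B C D E a b c d)
  (solve 9 (entry e₁₃) refl A B C D E a b c d) (solve 9 (entry e₂₁) refl A B C D E a b c d)
  (solve 9 (entry e₂₂) refl A B C D E a b c d) (solve 9 (entry e₂₃) refl A B C D E a b c d)
  (solve 9 (entry e₃₁) refl A B C D E a b c d) (solve 9 (entry e₃₂) refl A B C D E a b c d)
  (solve 9 (entry e₃₃) refl A B C D E a b c d)
  where
  entry : (∀ {R} → Mat₃ R → R) → (A B C D E a b c d : Polynomial 9) → Polynomial 9 × Polynomial 9
  entry π A B C D E a b c d =
    let σ = S.substCoeff A B C D E a b c d in
    π (S.catalecticantF (σ 0) (σ 1) (σ 2) (σ 3) (σ 4))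
      := π (S.sym² a b c d S.· S.catalecticantF A B C D E S.· transpose (S.sym² a b c d))

disc-numerator : ∀ f → + 4 * invI f ^ 3 - invJ f ^ 2 ≡ + 27 * (c0 f * discP f + c1 f ^ 2 * discQ f)
disc-numerator (quartic A B C D E) = solve 5 (λ A B C D E →
  con (+ 4) :* S.invIF A B C D E :^ 3 :- S.invJF A B C D E :^ 2
    := con (+ 27) :* (A :* S.discPF A B C D E :+ B :^ 2 :* S.discQF A B C D E)) refl A B C D E

invJ-substForm : ∀ f a b c d → invJ (substForm f a b c d) ≡ det a b c d ^ 6 * invJ f
invJ-substForm f a b c d =
  *-cancelˡ-≡ (+ 4) (invJ (substForm f a b c d)) (det a b c d ^ 6 * invJ f) (begin
  + 4 * invJ (substForm f a b c d)
    ≡⟨ sym (det₃-catalecticant (substForm f a b c d)) ⟩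
  det₃ (catalecticant (substForm f a b c d))
    ≡⟨ cong det₃ (catalecticant-substForm f a b c d) ⟩
  det₃ (Q · catalecticant f · transpose Q)
    ≡⟨ det₃-· (Q · catalecticant f) (transpose Q) ⟩
  det₃ (Q · catalecticant f) * det₃ (transpose Q)
    ≡⟨ cong₂ _*_ (det₃-· Q (catalecticant f)) (det₃-transpose Q) ⟩
  det₃ Q * det₃ (catalecticant f) * det₃ Q
    ≡⟨ cong₂ (λ x y → x * y * x) (det₃-sym² a b c d) (det₃-catalecticant f) ⟩
  T ^ 3 * (+ 4 * invJ f) * T ^ 3
    ≡⟨ solve 2 (λ T J → T :^ 3 :* (con (+ 4) :* J) :* T :^ 3 := con (+ 4) :* (T :^ 6 :* J))
         refl T (invJ f) ⟩
  + 4 * (T ^ 6 * invJ f)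
    ∎)
  where
  T : ℤ
  T = det a b c d
  Q : Mat₃ ℤ
  Q = sym² a b c d

n*k/n≡k : ∀ n k .{{_ : NonZero n}} → (n * k) / n ≡ k
n*k/n≡k n k = sym (i-j≡0⇒i≡j k q (∣i∣≡0⇒i≡0 (ℕ.n<1⇒n≡0 (ℕ.*-cancelʳ-< ∣ n ∣ ∣ k - q ∣ 1 (
  subst₂ ℕ._<_ (trans (cong ∣_∣ r≡[k-q]n) (abs-* (k - q) n)) (sym (ℕ.*-identityˡ ∣ n ∣))
    (n%d<d (n * k) n))))))
  where
  q : ℤ
  q = (n * k) / n
  r≡[k-q]n : + ((n * k) % n) ≡ (k - q) * n
  r≡[k-q]n = begin
    + ((n * k) % n)
      ≡⟨ solve 3 (λ r q n → r := r :+ q :* n :- q :* n) refl (+ ((n * k) % n)) q n ⟩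
    + ((n * k) % n) + q * n - q * n
      ≡⟨ cong (_- q * n) (sym (a≡a%n+[a/n]*n (n * k) n)) ⟩
    n * k - q * n
      ≡⟨ solve 3 (λ n k q → n :* k :- q :* n := (k :- q) :* n) refl n k q ⟩
    (k - q) * n
      ∎

disc-expansion : ∀ f → disc f ≡ c0 f * discP f + c1 f ^ 2 * discQ f
disc-expansion f =
  trans (cong (_/ + 27) (disc-numerator f)) (n*k/n≡k (+ 27) (c0 f * discP f + c1 f ^ 2 * discQ f))

disc-substForm-unimodular : ∀ f a b c d → det a b c d ≡ 1ℤ → disc (substForm f a b c d) ≡ disc f
disc-substForm-unimodular f a b c d det≡1 =
  cong₂ (λ I J → (+ 4 * I ^ 3 - J ^ 2) / + 27)
    (trans (invI-substForm f a b c d) (trans (cong (λ t → t ^ 4 * invI f) det≡1) (*-identityˡ (invI f))))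
    (trans (invJ-substForm f a b c d) (trans (cong (λ t → t ^ 6 * invJ f) det≡1) (*-identityˡ (invJ f))))

coprime-* : ∀ {m n o} → ℕ.Coprime m n → ℕ.Coprime m o → ℕ.Coprime m (n ℕ.* o)
coprime-* m⊥n m⊥o (i∣m , i∣no) =
  m⊥o (i∣m , ℕ.coprime-divisor (λ (j∣i , j∣n) → m⊥n (ℕ.∣-trans j∣i i∣m , j∣n)) i∣no)

coprime-^ : ∀ {m n} k → ℕ.Coprime m n → ℕ.Coprime m (n ℕ.^ k)
coprime-^ zero    _   (_ , i∣1) = ℕ.∣1⇒≡1 i∣1
coprime-^ (suc k) m⊥n = coprime-* m⊥n (coprime-^ k m⊥n)

coprime-gcd∧∣^⇒coprime : ∀ {g c d} k → ℕ.Coprime g (ℕ.gcd c d) → g ℕ.∣ d ℕ.^ k → ℕ.Coprime g c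
coprime-gcd∧∣^⇒coprime k g⊥e g∣dᵏ (i∣g , i∣c) =
  coprime-^ k (λ (j∣i , j∣d) → g⊥e (ℕ.∣-trans j∣i i∣g , ℕ.gcd-greatest (ℕ.∣-trans j∣i i∣c) j∣d))
    (ℕ.∣-refl , ℕ.∣-trans i∣g g∣dᵏ)

coprime-gcd∧∣^∧∣^⇒≡1 : ∀ {g c d} k → ℕ.Coprime g (ℕ.gcd c d) → g ℕ.∣ c ℕ.^ k → g ℕ.∣ d ℕ.^ k → g ≡ 1
coprime-gcd∧∣^∧∣^⇒≡1 k g⊥e g∣cᵏ g∣dᵏ =
  coprime-^ k (coprime-gcd∧∣^⇒coprime k g⊥e g∣dᵏ) (ℕ.∣-refl , g∣cᵏ)

abs-^ : ∀ i n → ∣ i ^ n ∣ ≡ ∣ i ∣ ℕ.^ n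
abs-^ i zero    = refl
abs-^ i (suc n) = trans (abs-* i (i ^ n)) (cong (∣ i ∣ ℕ.*_) (abs-^ i n))

abs≡unit* : ∀ i → ∃ λ s → + ∣ i ∣ ≡ s * i
abs≡unit* i with +∣i∣≡i⊎+∣i∣≡-i i
... | inj₁ eq = 1ℤ  , trans eq (sym (*-identityˡ i))
... | inj₂ eq = -1ℤ , trans eq (sym (-1*i≡-i i))

ℕ-Bézout⇒det≡1 : ∀ {x y} i j {s t} → + ∣ i ∣ ≡ s * i → + ∣ j ∣ ≡ t * j →
           1 ℕ.+ y ℕ.* ∣ j ∣ ≡ x ℕ.* ∣ i ∣ → det i j (+ y * t) (+ x * s) ≡ 1ℤ
ℕ-Bézout⇒det≡1 {x} {y} i j {s} {t} ∣i∣≡si ∣j∣≡tj eq = begin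
  i * (+ x * s) - j * (+ y * t)
    ≡⟨ solve 6 (λ i j x s y t → i :* (x :* s) :- j :* (y :* t) := x :* (s :* i) :- y :* (t :* j))
         refl i j (+ x) s (+ y) t ⟩
  + x * (s * i) - + y * (t * j)          ≡⟨ cong₂ (λ u v → + x * u - + y * v) (sym ∣i∣≡si) (sym ∣j∣≡tj) ⟩
  + x * + ∣ i ∣ - + y * + ∣ j ∣           ≡⟨ cong₂ _-_ (sym (pos-* x ∣ i ∣)) (sym (pos-* y ∣ j ∣)) ⟩
  + (x ℕ.* ∣ i ∣) - + (y ℕ.* ∣ j ∣)       ≡⟨ cong (λ z → + z - + (y ℕ.* ∣ j ∣)) (sym eq) ⟩
  + (1 ℕ.+ y ℕ.* ∣ j ∣) - + (y ℕ.* ∣ j ∣) ≡⟨ cong (_- + (y ℕ.* ∣ j ∣)) (pos-+ 1 (y ℕ.* ∣ j ∣)) ⟩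
  1ℤ + + (y ℕ.* ∣ j ∣) - + (y ℕ.* ∣ j ∣)
    ≡⟨ solve 1 (λ z → con 1ℤ :+ z :- z := con 1ℤ) refl (+ (y ℕ.* ∣ j ∣)) ⟩
  1ℤ                                     ∎

det-swap : ∀ a b c d → det a b (- d) (- c) ≡ det b a c d
det-swap = solve 4 (λ a b c d → S.detF a b (:- d) (:- c) := S.detF b a c d) refl

coprime-row⇒unimodular : ∀ a b → gcd a b ≡ + 1 → ∃₂ λ c d → det a b c d ≡ 1ℤ
coprime-row⇒unimodular a b gcd≡1
  with abs≡unit* a | abs≡unit* b | ℕ.coprime-Bézout (ℕ.gcd≡1⇒coprime (+-injective gcd≡1))
... | s , ∣a∣≡sa | t , ∣b∣≡tb | ℕ.Bézout.+- x y eq =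
  + y * t , + x * s , ℕ-Bézout⇒det≡1 {x} {y} a b ∣a∣≡sa ∣b∣≡tb eq
... | s , ∣a∣≡sa | t , ∣b∣≡tb | ℕ.Bézout.-+ x y eq =
  - (+ y * t) , - (+ x * s) ,
  trans (det-swap a b (+ x * s) (+ y * t)) (ℕ-Bézout⇒det≡1 {y} {x} b a ∣b∣≡tb ∣a∣≡sa eq)

eval-substForm-adjugate₁ : ∀ f a b c d → eval (substForm f a b c d) d (- b) ≡ c0 f * det a b c d ^ 4
eval-substForm-adjugate₁ f a b c d = begin
  eval (substForm f a b c d) d (- b)            ≡⟨ eval-substForm f a b c d d (- b) ⟩
  eval f (a * d + c * (- b)) (b * d + d * (- b))
    ≡⟨ cong₂ (eval f) (solve 4 (λ a b c d → a :* d :+ c :* (:- b) := S.detF a b c d) refl a b c d)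
                      (solve 2 (λ b d → b :* d :+ d :* (:- b) := con 0ℤ) refl b d) ⟩
  eval f (det a b c d) 0ℤ                       ≡⟨ eval-on-X-axis f (det a b c d) ⟩
  c0 f * det a b c d ^ 4                        ∎

eval-substForm-adjugate₂ : ∀ f a b c d → eval (substForm f a b c d) (- c) a ≡ c4 f * det a b c d ^ 4
eval-substForm-adjugate₂ f a b c d = begin
  eval (substForm f a b c d) (- c) a            ≡⟨ eval-substForm f a b c d (- c) a ⟩
  eval f (a * (- c) + c * a) (b * (- c) + d * a)
    ≡⟨ cong₂ (eval f) (solve 2 (λ a c → a :* (:- c) :+ c :* a := con 0ℤ) refl a c)
                      (solve 4 (λ a b c d → b :* (:- c) :+ d :* a := S.detF a b c d) refl a b c d) ⟩
  eval f 0ℤ (det a b c d)                       ≡⟨ eval-on-Y-axis f (det a b c d) ⟩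
  c4 f * det a b c d ^ 4                        ∎

monic∧∣y∧∣eval⇒∣x⁴ : ∀ {g} h x y → c0 h ≡ 1ℤ → g ℤˢ.∣ y → g ℤˢ.∣ eval h x y → g ℤˢ.∣ x ^ 4
monic∧∣y∧∣eval⇒∣x⁴ {g} h x y monic g∣y g∣h[x,y] =
  subst (g ℤˢ.∣_) (trans (cong (_* x ^ 4) monic) (*-identityˡ (x ^ 4)))
    (ℤˢ.∣m+n∣n⇒∣m (subst (g ℤˢ.∣_) (eval-leading-term h x y) g∣h[x,y]) (ℤˢ.∣m⇒∣m*n _ g∣y))

first-row-coprime : ∀ f h a b c d → det a b c d ≢ 0ℤ → gcd (gcd a b) (gcd c d) ≡ + 1 → c0 h ≡ 1ℤ →
             substForm f a b c d ≡ scale (det a b c d ^ 2) h → gcd a b ≡ + 1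
first-row-coprime f h a b c d T≢0 gcd≡1 monic S≡T²h =
  cong +_ (coprime-gcd∧∣^∧∣^⇒≡1 {ℕ.gcd ∣ a ∣ ∣ b ∣} {∣ c ∣} {∣ d ∣} 4
             (ℕ.gcd≡1⇒coprime (+-injective gcd≡1)) g∣c⁴ g∣d⁴)
  where
  T g : ℤ
  T = det a b c d
  g = gcd a b

  instance
    T²≢0 : NonZero (T ^ 2)
    T²≢0 = ≢-nonZero (λ T²≡0 → T≢0 (i^n≡0⇒i≡0 T 2 T²≡0))

  g∣a : g ℤˢ.∣ a
  g∣a = ℤˢ.∣ᵤ⇒∣ (gcd[i,j]∣i a b)
  g∣b : g ℤˢ.∣ b
  g∣b = ℤˢ.∣ᵤ⇒∣ (gcd[i,j]∣j a b)
  g∣T : g ℤˢ.∣ T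
  g∣T = ℤˢ.∣m∣n⇒∣m-n (ℤˢ.∣m⇒∣m*n d g∣a) (ℤˢ.∣m⇒∣m*n c g∣b)

  g∣x⁴ : ∀ {x y} k → eval (substForm f a b c d) x y ≡ k * T ^ 4 → g ℤˢ.∣ y → g ℤˢ.∣ x ^ 4
  g∣x⁴ {x} {y} k S[x,y]≡kT⁴ g∣y = monic∧∣y∧∣eval⇒∣x⁴ h x y monic g∣y
    (subst (g ℤˢ.∣_) (sym h[x,y]≡kT²) (ℤˢ.∣n⇒∣m*n k (ℤˢ.∣m⇒∣m*n (T * 1ℤ) g∣T)))
    where
    h[x,y]≡kT² : eval h x y ≡ k * T ^ 2
    h[x,y]≡kT² = *-cancelˡ-≡ (T ^ 2) (eval h x y) (k * T ^ 2) (begin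
      T ^ 2 * eval h x y              ≡⟨ sym (eval-scale (T ^ 2) h x y) ⟩
      eval (scale (T ^ 2) h) x y      ≡⟨ cong (λ F → eval F x y) (sym S≡T²h) ⟩
      eval (substForm f a b c d) x y  ≡⟨ S[x,y]≡kT⁴ ⟩
      k * T ^ 4
        ≡⟨ solve 2 (λ k T → k :* T :^ 4 := T :^ 2 :* (k :* T :^ 2)) refl k T ⟩
      T ^ 2 * (k * T ^ 2)             ∎)

  g∣c⁴ : ℕ.gcd ∣ a ∣ ∣ b ∣ ℕ.∣ ∣ c ∣ ℕ.^ 4
  g∣c⁴ = subst (ℕ.gcd ∣ a ∣ ∣ b ∣ ℕ.∣_) (trans (abs-^ (- c) 4) (cong (ℕ._^ 4) (∣-i∣≡∣i∣ c)))
           (ℤˢ.∣⇒∣ᵤ (g∣x⁴ (c4 f) (eval-substForm-adjugate₂ f a b c d) g∣a))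
  g∣d⁴ : ℕ.gcd ∣ a ∣ ∣ b ∣ ℕ.∣ ∣ d ∣ ℕ.^ 4
  g∣d⁴ = subst (ℕ.gcd ∣ a ∣ ∣ b ∣ ℕ.∣_) (abs-^ d 4)
           (ℤˢ.∣⇒∣ᵤ (g∣x⁴ (c0 f) (eval-substForm-adjugate₁ f a b c d) (ℤˢ.∣m⇒∣-m g∣b)))

cramerˣ : ∀ a b c d x y → det a b c d * x ≡ d * (a * x + b * y) - b * (c * x + d * y)
cramerˣ = solve 6 (λ a b c d x y →
  S.detF a b c d :* x := d :* (a :* x :+ b :* y) :- b :* (c :* x :+ d :* y)) refl

cramerʸ : ∀ a b c d x y → det a b c d * y ≡ a * (c * x + d * y) - c * (a * x + b * y)
cramerʸ = solve 6 (λ a b c d x y →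
  S.detF a b c d :* y := a :* (c :* x :+ d :* y) :- c :* (a :* x :+ b :* y)) refl

gradient-at-first-row : ∀ f a b c d → c1 (substForm f a b c d) ≡ 0ℤ →
  det a b c d * ∂X f a b ≡ + 4 * d * eval f a b × det a b c d * ∂Y f a b ≡ - (+ 4 * c * eval f a b)
gradient-at-first-row f a b c d c1≡0 = (begin
    det a b c d * fₓ                              ≡⟨ cramerˣ a b c d fₓ fᵧ ⟩
    d * (a * fₓ + b * fᵧ) - b * (c * fₓ + d * fᵧ)
      ≡⟨ cong₂ (λ u v → d * u - b * v) (euler f a b) c*fₓ+d*fᵧ≡0 ⟩
    d * (+ 4 * eval f a b) - b * 0ℤ               ≡⟨ simplifyˣ b d (eval f a b) ⟩
    + 4 * d * eval f a b                          ∎)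
  , (begin
    det a b c d * fᵧ                              ≡⟨ cramerʸ a b c d fₓ fᵧ ⟩
    a * (c * fₓ + d * fᵧ) - c * (a * fₓ + b * fᵧ)
      ≡⟨ cong₂ (λ u v → a * u - c * v) c*fₓ+d*fᵧ≡0 (euler f a b) ⟩
    a * 0ℤ - c * (+ 4 * eval f a b)               ≡⟨ simplifyʸ a c (eval f a b) ⟩
    - (+ 4 * c * eval f a b)                      ∎)
  where
  fₓ fᵧ : ℤ
  fₓ = ∂X f a b
  fᵧ = ∂Y f a b
  c*fₓ+d*fᵧ≡0 : c * fₓ + d * fᵧ ≡ 0ℤ
  c*fₓ+d*fᵧ≡0 = trans (sym (c1-substForm f a b c d)) c1≡0
  simplifyˣ : ∀ b d e → d * (+ 4 * e) - b * 0ℤ ≡ + 4 * d * e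
  simplifyˣ = solve 3 (λ b d e → d :* (con (+ 4) :* e) :- b :* con 0ℤ := con (+ 4) :* d :* e) refl
  simplifyʸ : ∀ a c e → a * 0ℤ - c * (+ 4 * e) ≡ - (+ 4 * c * e)
  simplifyʸ = solve 3 (λ a c e → a :* con 0ℤ :- c :* (con (+ 4) :* e) := :- (con (+ 4) :* c :* e)) refl

det²∣disc : ∀ f a b c d → det a b c d ≢ 0ℤ → gcd a b ≡ + 1 → eval f a b ≡ det a b c d ^ 2 →
            c1 (substForm f a b c d) ≡ 0ℤ → det a b c d ^ 2 ∣ disc f
det²∣disc f a b c d T≢0 gcd≡1 f[a,b]≡T² c1≡0 with coprime-row⇒unimodular a b gcd≡1
... | c' , d' , det'≡1 = ℤˢ.∣⇒∣ᵤ (ℤˢ.divides (discP F + w ^ 2 * discQ F) (begin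
  disc f                                  ≡⟨ sym (disc-substForm-unimodular f a b c' d' det'≡1) ⟩
  disc F                                  ≡⟨ disc-expansion F ⟩
  c0 F * discP F + c1 F ^ 2 * discQ F     ≡⟨ cong₂ (λ x y → x * discP F + y ^ 2 * discQ F)
                                               (trans (c0-substForm f a b c' d') f[a,b]≡T²) c1F≡Tw ⟩
  T ^ 2 * discP F + (T * w) ^ 2 * discQ F ≡⟨ regroup T w (discP F) (discQ F) ⟩
  (discP F + w ^ 2 * discQ F) * T ^ 2     ∎))
  where
  T w : ℤ
  T = det a b c d
  w = + 4 * (c' * d - d' * c)
  F : Quartic
  F = substForm f a b c' d'

  instance
    T≢0' : NonZero T
    T≢0' = ≢-nonZero T≢0

  regroup : ∀ T w P Q → T ^ 2 * P + (T * w) ^ 2 * Q ≡ (P + w ^ 2 * Q) * T ^ 2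
  regroup = solve 4 (λ T w P Q → T :^ 2 :* P :+ (T :* w) :^ 2 :* Q := (P :+ w :^ 2 :* Q) :* T :^ 2) refl

  distrib : ∀ T c' d' x y → T * (c' * x + d' * y) ≡ c' * (T * x) + d' * (T * y)
  distrib = solve 5 (λ T c' d' x y → T :* (c' :* x :+ d' :* y) := c' :* (T :* x) :+ d' :* (T :* y)) refl

  collect : ∀ c' d' c d T → c' * (+ 4 * d * T ^ 2) + d' * (- (+ 4 * c * T ^ 2))
                            ≡ T * (T * (+ 4 * (c' * d - d' * c)))
  collect = solve 5 (λ c' d' c d T →
    c' :* (con (+ 4) :* d :* T :^ 2) :+ d' :* (:- (con (+ 4) :* c :* T :^ 2))
      := T :* (T :* (con (+ 4) :* (c' :* d :- d' :* c)))) refl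

  Tfₓ≡ : T * ∂X f a b ≡ + 4 * d * eval f a b
  Tfₓ≡ = proj₁ (gradient-at-first-row f a b c d c1≡0)
  Tfᵧ≡ : T * ∂Y f a b ≡ - (+ 4 * c * eval f a b)
  Tfᵧ≡ = proj₂ (gradient-at-first-row f a b c d c1≡0)

  c1F≡Tw : c1 F ≡ T * w
  c1F≡Tw = *-cancelˡ-≡ T (c1 F) (T * w) (begin
    T * c1 F                                            ≡⟨ cong (T *_) (c1-substForm f a b c' d') ⟩
    T * (c' * ∂X f a b + d' * ∂Y f a b)                 ≡⟨ distrib T c' d' (∂X f a b) (∂Y f a b) ⟩
    c' * (T * ∂X f a b) + d' * (T * ∂Y f a b)           ≡⟨ cong₂ (λ u v → c' * u + d' * v) Tfₓ≡ Tfᵧ≡ ⟩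
    c' * (+ 4 * d * eval f a b) + d' * (- (+ 4 * c * eval f a b))
      ≡⟨ cong (λ e → c' * (+ 4 * d * e) + d' * (- (+ 4 * c * e))) f[a,b]≡T² ⟩
    c' * (+ 4 * d * T ^ 2) + d' * (- (+ 4 * c * T ^ 2)) ≡⟨ collect c' d' c d T ⟩
    T * (T * w)                                         ∎)

lemma3p2 : (a₂ a₃ a₄ : ℤ) (a b c d : ℤ) →
    det a b c d ≢ + 0 →
    gcd (gcd a b) (gcd c d) ≡ + 1 →
    TwistFlattened (quartic (+ 1) (+ 0) a₂ a₃ a₄) a b c d →
    (gcd a b ≡ + 1) ×
    (eval (quartic (+ 1) (+ 0) a₂ a₃ a₄) a b ≡ det a b c d ^ 2) ×
    (det a b c d ^ 2 ∣ disc (quartic (+ 1) (+ 0) a₂ a₃ a₄))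
lemma3p2 a₂ a₃ a₄ a b c d T≢0 gcd≡1 (h , (monic , flat) , (e₀ , e₁ , e₂ , e₃ , e₄)) =
  gcd≡1′ , f[a,b]≡T² , det²∣disc f a b c d T≢0 gcd≡1′ f[a,b]≡T² c1≡0
  where
  f : Quartic
  f = quartic (+ 1) (+ 0) a₂ a₃ a₄
  T² : ℤ
  T² = det a b c d ^ 2
  gcd≡1′ : gcd a b ≡ + 1
  gcd≡1′ = first-row-coprime f h a b c d T≢0 gcd≡1 monic
             (quartic-≡ {substForm f a b c d} {scale T² h} e₀ e₁ e₂ e₃ e₄)
  f[a,b]≡T² : eval f a b ≡ T²
  f[a,b]≡T² =
    trans (sym (c0-substForm f a b c d)) (trans e₀ (trans (cong (T² *_) monic) (*-identityʳ T²)))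
  c1≡0 : c1 (substForm f a b c d) ≡ 0ℤ
  c1≡0 = trans e₁ (trans (cong (T² *_) flat) (*-zeroʳ T²))
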